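{- For $n\ge1$ let $d_{n,4}(q):=\sum_{w\in\mathcal F_{n,2}}q^{\deg_4(G(w))}$. Then for all $n\ge3$, $$d_{n,4}(q)=d_{n-1,4}(q)+q^2d_{n-2,4}(q),$$ with $d_{1,4}(q)=2$ and $d_{2,4}(q)=1+2q$. Moreover, for all $n\ge1$, $$d_{n,4}(q)=\sum_{i=0}^{n+2}\left(\binom{n-1-\lfloor (i-2)/2\rfloor}{\lfloor (i-3)/2\rfloor}+\binom{n-2-\lfloor (i-3)/2\rfloor}{\lfloor (i-4)/2\rfloor}\right)q^{i-3}.$$
   Context: $\mathcal F_{n,2}$ is the set of binary words $w=w_1\cdots w_n$ with no two consecutive $1$'s. $P(w)$ is the bargraph polyomino formed by the unit squares $[i-1,i]\times[j-1,j]$, $1\le i\le n$, $1\le j\le w_i+1$. $G(w)$ is the graph whose vertices are the corners of the cells of $P(w)$ and whose edges are the cell sides. $\deg_4(G)$ is the number of vertices of degree $4$ in $G$. Binomial coefficients with integer arguments follow the convention $\binom{a}{a}=1$ for every integer $a$ (in particular $\binom{ -1}{ -1}=1$), $\binom{a}{b}=0$ if $b>a$, and $\binom{a}{b}=0$ if $b<0$ and $b\ne a$. -}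

module Defs where

open import Data.Bool using (Bool; true; false; T; _∧_; _∨_; if_then_else_)
open import Data.Bool.Properties using (T?)
open import Data.Nat as ℕ using (ℕ; zero; suc; _≤ᵇ_; _≡ᵇ_)
open import Data.Nat.Combinatorics using (_C_)
open import Data.Integer as ℤ using (ℤ; +_; -[1+_]; _/ℕ_)
open import Data.List using (List; []; _∷_; filter; concatMap; upTo; length; foldr)
open import Function using (_∘_)
open import Relation.Nullary.Decidable using (does)

-- all binary words of length n (true = letter 1, false = letter 0)
words : ℕ → List (List Bool)
words zero    = [] ∷ []
words (suc n) = concatMap (λ w → (false ∷ w) ∷ (true ∷ w) ∷ []) (words n)

no11 : List Bool → Bool
no11 []                 = true
no11 (_ ∷ [])           = true
no11 (true ∷ true ∷ w)  = false
no11 (_ ∷ b ∷ w)        = no11 (b ∷ w)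

F2 : ℕ → List (List Bool)
F2 n = filter (T? ∘ no11) (words n)

bit : Bool → ℕ
bit true  = 1
bit false = 0

-- height of column i (1-based) of P(w), i.e. w_i + 1; 0 outside 1 ≤ i ≤ n
colH : List Bool → ℕ → ℕ
colH []      _             = 0
colH (_ ∷ _) zero          = 0
colH (b ∷ _) (suc zero)    = suc (bit b)
colH (_ ∷ w) (suc (suc i)) = colH w (suc i)

-- cell [i-1,i]×[j-1,j] belongs to P(w)  iff  1 ≤ i ≤ n and 1 ≤ j ≤ w_i + 1
cell : List Bool → ℕ → ℕ → Bool
cell w i j = (1 ≤ᵇ j) ∧ (j ≤ᵇ colH w i)

-- the horizontal unit segment (x,y)–(x+1,y) is a side of a cell of P(w)
-- (of the cell just above it or the cell just below it)
hEdge : List Bool → ℕ → ℕ → Bool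
hEdge w x y = cell w (suc x) (suc y) ∨ cell w (suc x) y

-- the vertical unit segment (x,y)–(x,y+1) is a side of a cell of P(w)
-- (of the cell to its left or the cell to its right)
vEdge : List Bool → ℕ → ℕ → Bool
vEdge w x y = cell w x (suc y) ∨ cell w (suc x) (suc y)

degree : List Bool → ℕ → ℕ → ℕ
degree w x y =
  bit (hEdge w x y)
  ℕ.+ bit (hEdgeL x)
  ℕ.+ bit (vEdge w x y)
  ℕ.+ bit (vEdgeD y)
  where
  hEdgeL : ℕ → Bool
  hEdgeL zero    = false
  hEdgeL (suc x′) = hEdge w x′ y
  vEdgeD : ℕ → Bool
  vEdgeD zero    = false
  vEdgeD (suc y′) = vEdge w x y′

count : {A : Set} → (A → Bool) → List A → ℕ
count p = foldr (λ a r → bit (p a) ℕ.+ r) 0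

-- deg_4(G(w)): number of vertices of G(w) of degree 4.  Every corner of a
-- cell of P(w) lies in [0,n]×[0,2] (heights are ≤ 2), and every lattice
-- point of positive degree is a corner of a cell, so we count lattice
-- points (x,y) with 0 ≤ x ≤ n, 0 ≤ y ≤ 2 having degree 4.
deg4 : List Bool → ℕ
deg4 w = foldr ℕ._+_ 0
  (Data.List.map (λ x → count (λ y → degree w x y ≡ᵇ 4) (upTo 3))
                 (upTo (suc (length w))))

-- Laurent polynomials in q with integer coefficients, represented by
-- their coefficient function (coefficient of q^e for e : ℤ); all the ones
-- below are finitely supported.

LPoly : Set
LPoly = ℤ → ℤ

qpow : ℤ → LPoly
qpow e k = if does (k ℤ.≟ e) then + 1 else + 0

_⊕_ : LPoly → LPoly → LPoly
(p ⊕ r) k = p k ℤ.+ r k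
infixl 6 _⊕_

_⊙_ : ℤ → LPoly → LPoly
(c ⊙ p) k = c ℤ.* p k
infixl 7 _⊙_

_·q^_ : LPoly → ℤ → LPoly
(p ·q^ e) k = p (k ℤ.- e)

zeroP : LPoly
zeroP _ = + 0

ΣP : ℕ → (ℕ → LPoly) → LPoly
ΣP zero    f = f 0
ΣP (suc m) f = ΣP m f ⊕ f (suc m)

d4 : ℕ → LPoly
d4 n = foldr (λ w p → qpow (+ deg4 w) ⊕ p) zeroP (F2 n)

-- Integer binomial coefficients with the paper's convention:
-- C(a,a) = 1 for every integer a; C(a,b) = 0 if b > a;
-- C(a,b) = 0 if b < 0 and b ≠ a; usual value otherwise (0 ≤ b ≤ a).
binomℤ : ℤ → ℤ → ℤ
binomℤ a b with does (b ℤ.≟ a)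
... | true  = + 1
... | false with a | b
...   | + a′ | + b′ = + (a′ C b′)
...   | _    | _    = + 0

-- ⌊ z / 2 ⌋ for integer z
half : ℤ → ℤ
half z = z /ℕ 2

-- Prepending a letter to a word creates a new vertex of degree 4 only at (1,1), and does so
-- unless both of the first two letters are 0.  Hence the generating functions Z_n and O_n of the
-- words of F_{n+1,2} starting with 0 and with 1 satisfy Z_{n+1} = Z_n + q O_n and O_{n+1} = q Z_n,
-- and eliminating them gives d_{n+3} = d_{n+2} + q^2 d_{n+1}.  For the closed form, write the
-- exponent as i = 2h+3 or i = 2h+4: the coefficient becomes C(n-1-h, h) + C(n-2-h, h-1),
-- respectively 2 C(n-2-h, h), and Pascal's rule (valid for the paper's integer binomials whenever
-- a + b ≥ 0) shows that it obeys the same recurrence.  It agrees with d_n for n = 1, 2, hence for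
-- all n, and by the same induction it vanishes outside 0 ≤ i ≤ n + 2.
module Submission where

open import Defs
open import Data.Bool using (Bool; true; false; if_then_else_; _∨_)
open import Data.Bool.Properties using (T?)
open import Data.Empty using (⊥-elim)
open import Data.Integer as ℤ using (ℤ; +_; -[1+_]; _+_; _-_; -_; _*_; +≤+)
open import Data.Integer.DivMod using (n%ℕd<d; a≡a%ℕn+[a/ℕn]*n)
import Data.Integer.Properties as ℤP
open import Algebra.Properties.AbelianGroup ℤP.+-0-abelianGroup using (∙-cancelˡ; ∙-cancelʳ)
open import Algebra.Properties.CommutativeSemigroup ℤP.+-commutativeSemigroup using (interchange)
open import Data.Integer.Tactic.RingSolver using (solve-∀)
open import Data.List using (List; []; _∷_; foldr; filter; concatMap; applyUpTo; upTo; length)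
open import Data.List.Properties using (map-upTo)
open import Data.Nat using (ℕ; zero; suc; _≤_; s≤s; z≤n; _≡ᵇ_)
import Data.Nat as ℕ
open import Data.Nat.Combinatorics using (_C_; nCn≡1; nCk+nC[k+1]≡[n+1]C[k+1])
import Data.Nat.Properties as ℕP
open import Data.Product using (_×_; _,_)
open import Function using (_∘_)
open import Relation.Binary.PropositionalEquality
open import Relation.Nullary using (yes; no)
open import Relation.Nullary.Decidable using (dec-true; dec-false)

qpow-diag : ∀ e → qpow e e ≡ + 1
qpow-diag e rewrite dec-true (e ℤ.≟ e) refl = refl

qpow-off : ∀ {e k} → k ≢ e → qpow e k ≡ + 0
qpow-off {e} {k} k≢e rewrite dec-false (k ℤ.≟ e) k≢e = refl

qpow-reindex : ∀ e k e′ k′ → e - k ≡ e′ - k′ → qpow e k ≡ qpow e′ k′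
qpow-reindex e k e′ k′ eq with k ℤ.≟ e | k′ ℤ.≟ e′
... | yes _     | yes _      = refl
... | no _      | no _       = refl
... | yes refl  | no k′≢e′   = ⊥-elim (k′≢e′ (sym (ℤP.i-j≡0⇒i≡j e′ k′ (trans (sym eq) (ℤP.+-inverseʳ e)))))
... | no k≢e    | yes refl   = ⊥-elim (k≢e (sym (ℤP.i-j≡0⇒i≡j e k (trans eq (ℤP.+-inverseʳ e′)))))

qpow-suc : ∀ e k → qpow (+ 1 + e) k ≡ qpow e (k - + 1)
qpow-suc e k = qpow-reindex (+ 1 + e) k e (k - + 1) (shift e k)
  where
  shift : ∀ e k → + 1 + e - k ≡ e - (k - + 1)
  shift = solve-∀

qpow-translate : ∀ e k c → qpow (e + c) (k + c) ≡ qpow e k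
qpow-translate e k c = qpow-reindex (e + c) (k + c) e k (cancel e k c)
  where
  cancel : ∀ e k c → e + c - (k + c) ≡ e - k
  cancel = solve-∀

double≢1 : ∀ x → x * + 2 ≢ + 1
double≢1 (+ zero)  ()
double≢1 (+ suc _) ()
double≢1 -[1+ _ ]  ()

qpow-double : ∀ e k → qpow (e * + 2) (k * + 2) ≡ qpow e k
qpow-double e k with k * + 2 ℤ.≟ e * + 2 | k ℤ.≟ e
... | yes _   | yes _   = refl
... | no _    | no _    = refl
... | yes 2k≡2e | no k≢e = ⊥-elim (k≢e (ℤP.*-cancelʳ-≡ k e (+ 2) 2k≡2e))
... | no 2k≢2e  | yes refl = ⊥-elim (2k≢2e refl)

qpow-affine : ∀ e k c → qpow (e * + 2 + c) (k * + 2 + c) ≡ qpow e k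
qpow-affine e k c = trans (qpow-translate (e * + 2) (k * + 2) c) (qpow-double e k)

qpow-wrongParity : ∀ e k c → qpow (e * + 2 + c + + 1) (k * + 2 + c) ≡ + 0
qpow-wrongParity e k c =
  trans (qpow-reindex (e * + 2 + c + + 1) (k * + 2 + c) (+ 1) ((k - e) * + 2) (difference e k c))
        (qpow-off (double≢1 (k - e)))
  where
  difference : ∀ e k c → e * + 2 + c + + 1 - (k * + 2 + c) ≡ + 1 - (k - e) * + 2
  difference = solve-∀

ΣP-cong : ∀ m {f g : ℕ → LPoly} k k′ → (∀ i → f i k ≡ g i k′) → ΣP m f k ≡ ΣP m g k′
ΣP-cong zero    k k′ f≡g = f≡g 0
ΣP-cong (suc m) k k′ f≡g = cong₂ _+_ (ΣP-cong m k k′ f≡g) (f≡g (suc m))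

ΣP-miss : ∀ m (c : ℕ → ℤ) x → (∀ i → i ≤ m → x ≢ + i) → ΣP m (λ i → c i ⊙ qpow (+ i)) x ≡ + 0
ΣP-miss zero    c x miss = trans (cong (c 0 *_) (qpow-off (miss 0 z≤n))) (ℤP.*-zeroʳ (c 0))
ΣP-miss (suc m) c x miss =
  cong₂ _+_ (ΣP-miss m c x (λ i i≤m → miss i (ℕP.m≤n⇒m≤1+n i≤m)))
            (trans (cong (c (suc m) *_) (qpow-off (miss (suc m) ℕP.≤-refl))) (ℤP.*-zeroʳ (c (suc m))))

ΣP-pick : ∀ m (c : ℕ → ℤ) j → j ≤ m → ΣP m (λ i → c i ⊙ qpow (+ i)) (+ j) ≡ c j
ΣP-pick zero    c zero z≤n = ℤP.*-identityʳ (c 0)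
ΣP-pick (suc m) c j j≤1+m with j ℕ.≟ suc m
... | yes refl = begin
  ΣP m (λ i → c i ⊙ qpow (+ i)) (+ suc m) + c (suc m) * qpow (+ suc m) (+ suc m)
    ≡⟨ cong₂ _+_ (ΣP-miss m c (+ suc m) (λ i i≤m → ℕP.>⇒≢ (s≤s i≤m) ∘ ℤP.+-injective))
                 (cong (c (suc m) *_) (qpow-diag (+ suc m))) ⟩
  + 0 + c (suc m) * + 1
    ≡⟨ trans (ℤP.+-identityˡ _) (ℤP.*-identityʳ (c (suc m))) ⟩
  c (suc m) ∎
  where open ≡-Reasoning
... | no j≢1+m = begin
  ΣP m (λ i → c i ⊙ qpow (+ i)) (+ j) + c (suc m) * qpow (+ suc m) (+ j)
    ≡⟨ cong₂ _+_ (ΣP-pick m c j (ℕP.≤-pred (ℕP.≤∧≢⇒< j≤1+m j≢1+m)))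
                 (cong (c (suc m) *_) (qpow-off (j≢1+m ∘ ℤP.+-injective))) ⟩
  c j + c (suc m) * + 0
    ≡⟨ trans (cong (_+_ (c j)) (ℤP.*-zeroʳ (c (suc m)))) (ℤP.+-identityʳ (c j)) ⟩
  c j ∎
  where open ≡-Reasoning

ΣP-coefficients : ∀ m (c : ℤ → ℤ) s →
  (∀ j → m ℕ.< j → c (+ j) ≡ + 0) → (∀ p → c -[1+ p ] ≡ + 0) →
  ∀ k → ΣP m (λ i → c (+ i) ⊙ qpow (+ i - s)) k ≡ c (k + s)
ΣP-coefficients m c s vanish⁺ vanish⁻ k =
  trans (ΣP-cong m k (k + s) (λ i → cong (c (+ i) *_)
           (qpow-reindex (+ i - s) k (+ i) (k + s) (shift (+ i) k s))))
        (expansion (k + s))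
  where
  shift : ∀ i k s → i - s - k ≡ i - (k + s)
  shift = solve-∀
  expansion : ∀ x → ΣP m (λ i → c (+ i) ⊙ qpow (+ i)) x ≡ c x
  expansion (+ j) with j ℕ.≤? m
  ... | yes j≤m = ΣP-pick m (c ∘ +_) j j≤m
  ... | no j≰m  =
    trans (ΣP-miss m (c ∘ +_) (+ j) (λ i i≤m → ℕP.>⇒≢ (ℕP.≤-<-trans i≤m (ℕP.≰⇒> j≰m)) ∘ ℤP.+-injective))
          (sym (vanish⁺ j (ℕP.≰⇒> j≰m)))
  expansion -[1+ p ] = trans (ΣP-miss m (c ∘ +_) -[1+ p ] (λ _ _ ())) (sym (vanish⁻ p))

column4 : List Bool → ℕ → ℕ
column4 w x = count (λ y → degree w x y ≡ᵇ 4) (upTo 3)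

column4-leftBorder : ∀ w → column4 w 0 ≡ 0
column4-leftBorder []          = refl
column4-leftBorder (false ∷ _) = refl
column4-leftBorder (true ∷ _)  = refl

-- The vertex (1,1) has degree 4 exactly when one of the first two columns has height 2.
column4-between : ∀ a b w → column4 (a ∷ b ∷ w) 1 ≡ bit (a ∨ b)
column4-between false false _ = refl
column4-between false true  _ = refl
column4-between true  false _ = refl
column4-between true  true  _ = refl

deg4-columns : ∀ w → deg4 w ≡ foldr ℕ._+_ 0 (applyUpTo (column4 w ∘ suc) (length w))
deg4-columns w =
  trans (cong (foldr ℕ._+_ 0) (map-upTo (column4 w) (suc (length w))))
        (cong (ℕ._+ foldr ℕ._+_ 0 (applyUpTo (column4 w ∘ suc) (length w))) (column4-leftBorder w))

deg4-∷∷ : ∀ a b w → deg4 (a ∷ b ∷ w) ≡ bit (a ∨ b) ℕ.+ deg4 (b ∷ w)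
deg4-∷∷ a b w = begin
  deg4 (a ∷ b ∷ w)                        ≡⟨ deg4-columns (a ∷ b ∷ w) ⟩
  column4 (a ∷ b ∷ w) 1 ℕ.+ foldr ℕ._+_ 0 (applyUpTo (column4 (b ∷ w) ∘ suc) (length (b ∷ w)))
    ≡⟨ cong₂ ℕ._+_ (column4-between a b w) (sym (deg4-columns (b ∷ w))) ⟩
  bit (a ∨ b) ℕ.+ deg4 (b ∷ w)            ∎
  where open ≡-Reasoning

-- The recurrence for d4

sumℤ : {A : Set} → (A → ℤ) → List A → ℤ
sumℤ f = foldr (λ a r → f a + r) (+ 0)

sumℤ-+ : ∀ {A : Set} (f g : A → ℤ) xs → sumℤ (λ a → f a + g a) xs ≡ sumℤ f xs + sumℤ g xs
sumℤ-+ f g []       = refl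
sumℤ-+ f g (x ∷ xs) = trans (cong (_+_ (f x + g x)) (sumℤ-+ f g xs)) (interchange (f x) (g x) _ _)

sumℤ-cong : ∀ {A : Set} {f g : A → ℤ} xs → (∀ a → f a ≡ g a) → sumℤ f xs ≡ sumℤ g xs
sumℤ-cong []       f≗g = refl
sumℤ-cong (x ∷ xs) f≗g = cong₂ _+_ (f≗g x) (sumℤ-cong xs f≗g)

sumℤ-words-suc : ∀ n (f : List Bool → ℤ) →
  sumℤ f (words (suc n)) ≡ sumℤ (λ w → f (false ∷ w) + f (true ∷ w)) (words n)
sumℤ-words-suc n f = go (words n)
  where
  go : ∀ ws → sumℤ f (concatMap (λ w → (false ∷ w) ∷ (true ∷ w) ∷ []) ws)
            ≡ sumℤ (λ w → f (false ∷ w) + f (true ∷ w)) ws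
  go []       = refl
  go (w ∷ ws) = trans (cong (λ r → f (false ∷ w) + (f (true ∷ w) + r)) (go ws))
                      (sym (ℤP.+-assoc (f (false ∷ w)) _ _))

weight : ℤ → List Bool → ℤ
weight k w = if no11 w then qpow (+ deg4 w) k else + 0

d4-sumℤ : ∀ n k → d4 n k ≡ sumℤ (weight k) (words n)
d4-sumℤ n k = go (words n)
  where
  go : ∀ ws → foldr (λ w p → qpow (+ deg4 w) ⊕ p) zeroP (filter (T? ∘ no11) ws) k ≡ sumℤ (weight k) ws
  go []       = refl
  go (w ∷ ws) with no11 w
  ... | true  = cong (_+_ (qpow (+ deg4 w) k)) (go ws)
  ... | false = trans (go ws) (sym (ℤP.+-identityˡ _))

weight-00 : ∀ k w → weight k (false ∷ false ∷ w) ≡ weight k (false ∷ w)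
weight-00 k w rewrite deg4-∷∷ false false w = refl

weight-01 : ∀ k w → weight k (false ∷ true ∷ w) ≡ weight (k - + 1) (true ∷ w)
weight-01 k w rewrite deg4-∷∷ false true w with no11 (true ∷ w)
... | true  = qpow-suc (+ deg4 (true ∷ w)) k
... | false = refl

weight-10 : ∀ k w → weight k (true ∷ false ∷ w) ≡ weight (k - + 1) (false ∷ w)
weight-10 k w rewrite deg4-∷∷ true false w with no11 (false ∷ w)
... | true  = qpow-suc (+ deg4 (false ∷ w)) k
... | false = refl

startingWith : Bool → ℕ → LPoly
startingWith b n k = sumℤ (λ w → weight k (b ∷ w)) (words n)

d4-suc : ∀ n → d4 (suc n) ≗ startingWith false n ⊕ startingWith true n
d4-suc n k = trans (d4-sumℤ (suc n) k)
  (trans (sumℤ-words-suc n (weight k)) (sumℤ-+ (weight k ∘ (false ∷_)) (weight k ∘ (true ∷_)) (words n)))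

startingWith0-suc : ∀ n → startingWith false (suc n) ≗ startingWith false n ⊕ (startingWith true n ·q^ (+ 1))
startingWith0-suc n k = begin
  startingWith false (suc n) k
    ≡⟨ sumℤ-words-suc n (λ w → weight k (false ∷ w)) ⟩
  sumℤ (λ w → weight k (false ∷ false ∷ w) + weight k (false ∷ true ∷ w)) (words n)
    ≡⟨ sumℤ-cong (words n) (λ w → cong₂ _+_ (weight-00 k w) (weight-01 k w)) ⟩
  sumℤ (λ w → weight k (false ∷ w) + weight (k - + 1) (true ∷ w)) (words n)
    ≡⟨ sumℤ-+ (weight k ∘ (false ∷_)) (weight (k - + 1) ∘ (true ∷_)) (words n) ⟩
  startingWith false n k + startingWith true n (k - + 1) ∎
  where open ≡-Reasoning

startingWith1-suc : ∀ n → startingWith true (suc n) ≗ startingWith false n ·q^ (+ 1)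
startingWith1-suc n k =
  trans (sumℤ-words-suc n (λ w → weight k (true ∷ w)))
        (sumℤ-cong (words n) (λ w → trans (ℤP.+-identityʳ _) (weight-10 k w)))

d4-rec : ∀ m → d4 (3 ℕ.+ m) ≗ d4 (2 ℕ.+ m) ⊕ (d4 (1 ℕ.+ m) ·q^ (+ 2))
d4-rec m k = begin
  d4 (3 ℕ.+ m) k
    ≡⟨ d4-suc (2 ℕ.+ m) k ⟩
  Z (2 ℕ.+ m) k + O (2 ℕ.+ m) k
    ≡⟨ cong₂ _+_ (startingWith0-suc (1 ℕ.+ m) k) (startingWith1-suc (1 ℕ.+ m) k) ⟩
  (Z (1 ℕ.+ m) k + O (1 ℕ.+ m) (k - + 1)) + Z (1 ℕ.+ m) (k - + 1)
    ≡⟨ cong₂ (λ x y → Z (1 ℕ.+ m) k + x + y) (startingWith1-suc m (k - + 1)) (startingWith0-suc m (k - + 1)) ⟩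
  (Z (1 ℕ.+ m) k + Z m (k - + 1 - + 1)) + (Z m (k - + 1) + O m (k - + 1 - + 1))
    ≡⟨ interchange (Z (1 ℕ.+ m) k) _ (Z m (k - + 1)) _ ⟩
  (Z (1 ℕ.+ m) k + Z m (k - + 1)) + (Z m (k - + 1 - + 1) + O m (k - + 1 - + 1))
    ≡⟨ cong₂ _+_ (cong (_+_ (Z (1 ℕ.+ m) k)) (sym (startingWith1-suc m k)))
                 (trans (cong (λ k′ → Z m k′ + O m k′) (twice-pred k)) (sym (d4-suc m (k - + 2)))) ⟩
  (Z (1 ℕ.+ m) k + O (1 ℕ.+ m) k) + d4 (1 ℕ.+ m) (k - + 2)
    ≡⟨ cong (_+ d4 (1 ℕ.+ m) (k - + 2)) (sym (d4-suc (1 ℕ.+ m) k)) ⟩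
  d4 (2 ℕ.+ m) k + d4 (1 ℕ.+ m) (k - + 2) ∎
  where
  open ≡-Reasoning
  Z O : ℕ → LPoly
  Z = startingWith false
  O = startingWith true
  twice-pred : ∀ k → k - + 1 - + 1 ≡ k - + 2
  twice-pred = solve-∀

d4-1 : d4 1 ≗ (+ 2) ⊙ qpow (+ 0)
d4-1 k = double (qpow (+ 0) k)
  where
  double : ∀ x → x + (x + + 0) ≡ + 2 * x
  double = solve-∀

d4-2 : d4 2 ≗ qpow (+ 0) ⊕ (+ 2) ⊙ qpow (+ 1)
d4-2 k = collect (qpow (+ 0) k) (qpow (+ 1) k)
  where
  collect : ∀ x y → x + (y + (y + + 0)) ≡ x + + 2 * y
  collect = solve-∀

binomℤ-diag : ∀ a → binomℤ a a ≡ + 1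
binomℤ-diag a rewrite dec-true (a ℤ.≟ a) refl = refl

binomℤ-nat : ∀ x y → binomℤ (+ x) (+ y) ≡ + (x C y)
binomℤ-nat x y with y ℕ.≟ x
... | yes refl rewrite binomℤ-diag (+ x) = cong +_ (sym (nCn≡1 x))
... | no y≢x   rewrite dec-false (+ y ℤ.≟ + x) (y≢x ∘ ℤP.+-injective) = refl

binomℤ-negTop : ∀ p b → b ≢ -[1+ p ] → binomℤ -[1+ p ] b ≡ + 0
binomℤ-negTop p b b≢a rewrite dec-false (b ℤ.≟ -[1+ p ]) b≢a = refl

≢-pred : ∀ z → z ≢ z - + 1
≢-pred z eq with ∙-cancelˡ z (+ 0) (- + 1) (trans (ℤP.+-identityʳ z) eq)
... | ()

pascal-negative-side : ∀ p b → + 0 ℤ.≤ -[1+ p ] + b → b ≢ -[1+ p ] - + 1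
pascal-negative-side p b () refl

-- Pascal's rule fails exactly at b = a - 1 with a ≤ 0, where a + b < 0.
binomℤ-pascal : ∀ a b → + 0 ℤ.≤ a + b →
  binomℤ a b ≡ binomℤ (a - + 1) b + binomℤ (a - + 1) (b - + 1)
binomℤ-pascal (+ suc x) (+ suc y) _
  rewrite binomℤ-nat (suc x) (suc y) | binomℤ-nat x (suc y) | binomℤ-nat x y =
  cong +_ (trans (sym (nCk+nC[k+1]≡[n+1]C[k+1] x y)) (ℕP.+-comm (x C y) _))
binomℤ-pascal (+ suc x) (+ zero)      _ rewrite binomℤ-nat (suc x) 0 | binomℤ-nat x 0 = refl
binomℤ-pascal (+ suc x) -[1+ _ ]      _ = refl
binomℤ-pascal (+ zero)  (+ zero)      _ = refl
binomℤ-pascal (+ zero)  (+ suc y)     _ rewrite binomℤ-nat 0 (suc y) = refl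
binomℤ-pascal (+ zero)  -[1+ suc _ ]  _ = refl
binomℤ-pascal -[1+ p ]  b             0≤a+b with b ℤ.≟ -[1+ p ]
... | yes refl rewrite binomℤ-negTop (suc (p ℕ.+ 0)) -[1+ p ] (≢-pred -[1+ p ])
                     | binomℤ-diag -[1+ suc (p ℕ.+ 0) ] = refl
... | no b≢a rewrite binomℤ-negTop (suc (p ℕ.+ 0)) b (pascal-negative-side p b 0≤a+b)
                   | binomℤ-negTop (suc (p ℕ.+ 0)) (b - + 1) (b≢a ∘ ∙-cancelʳ (- + 1) b -[1+ p ]) = refl

binomℤ-congˡ : ∀ {a a′} b → a ≡ a′ → binomℤ a b ≡ binomℤ a′ b
binomℤ-congˡ b = cong (λ a → binomℤ a b)

≡+⇒0≤ : ∀ {z k} → z ≡ + k → + 0 ℤ.≤ z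
≡+⇒0≤ refl = +≤+ z≤n

even≢odd : ∀ h h′ → + 0 + h * + 2 ≢ + 1 + h′ * + 2
even≢odd h h′ eq = double≢1 (h - h′) (begin
  (h - h′) * + 2              ≡⟨ expand h h′ ⟩
  (+ 0 + h * + 2) - h′ * + 2  ≡⟨ cong (λ z → z - h′ * + 2) eq ⟩
  (+ 1 + h′ * + 2) - h′ * + 2 ≡⟨ collapse h′ ⟩
  + 1                         ∎)
  where
  open ≡-Reasoning
  expand : ∀ h h′ → (h - h′) * + 2 ≡ (+ 0 + h * + 2) - h′ * + 2
  expand = solve-∀
  collapse : ∀ h′ → (+ 1 + h′ * + 2) - h′ * + 2 ≡ + 1
  collapse = solve-∀

bit+double-injective : ∀ {r r′} h h′ → r ℕ.< 2 → r′ ℕ.< 2 → + r + h * + 2 ≡ + r′ + h′ * + 2 → h ≡ h′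
bit+double-injective {0} {0} h h′ _ _ eq = ℤP.*-cancelʳ-≡ h h′ (+ 2) (∙-cancelˡ (+ 0) _ _ eq)
bit+double-injective {1} {1} h h′ _ _ eq = ℤP.*-cancelʳ-≡ h h′ (+ 2) (∙-cancelˡ (+ 1) _ _ eq)
bit+double-injective {0} {1} h h′ _ _ eq = ⊥-elim (even≢odd h h′ eq)
bit+double-injective {1} {0} h h′ _ _ eq = ⊥-elim (even≢odd h′ h (sym eq))
bit+double-injective {suc (suc _)} _ _ (s≤s (s≤s ())) _ _
bit+double-injective {_} {suc (suc _)} _ _ _ (s≤s (s≤s ())) _

half-bit+double : ∀ {z} h r → r ℕ.< 2 → z ≡ + r + h * + 2 → half z ≡ h
half-bit+double {z} h r r<2 refl =
  sym (bit+double-injective h (half z) r<2 (n%ℕd<d z 2) (a≡a%ℕn+[a/ℕn]*n z 2))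

ℤ-parityElim : ∀ (P : ℤ → Set) → (∀ h → P (h * + 2 + + 3)) → (∀ h → P (h * + 2 + + 4)) → ∀ x → P x
ℤ-parityElim P odd even x = split ((x - + 3) ℤ.%ℕ 2) (n%ℕd<d (x - + 3) 2) (a≡a%ℕn+[a/ℕn]*n (x - + 3) 2)
  where
  unshift : ∀ x h c → x - + 3 ≡ c + h * + 2 → x ≡ h * + 2 + (c + + 3)
  unshift x h c eq = trans (sym (x-3+3 x)) (trans (cong (_+ + 3) eq) (reorder c h))
    where
    x-3+3 : ∀ x → x - + 3 + + 3 ≡ x
    x-3+3 = solve-∀
    reorder : ∀ c h → c + h * + 2 + + 3 ≡ h * + 2 + (c + + 3)
    reorder = solve-∀
  h : ℤ
  h = half (x - + 3)
  split : ∀ r → r ℕ.< 2 → x - + 3 ≡ + r + h * + 2 → P x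
  split 0             _              eq = subst P (sym (unshift x h (+ 0) eq)) (odd h)
  split 1             _              eq = subst P (sym (unshift x h (+ 1) eq)) (even h)
  split (suc (suc _)) (s≤s (s≤s ())) _

-- The coefficients of the closed form

coeff : ℕ → ℤ → ℤ
coeff n i = binomℤ (+ n - + 1 - half (i - + 2)) (half (i - + 3))
          + binomℤ (+ n - + 2 - half (i - + 3)) (half (i - + 4))

oddPart evenPart : ℕ → ℤ → ℤ
oddPart  n h = binomℤ (+ n - + 1 - h) h + binomℤ (+ n - + 2 - h) (h - + 1)
evenPart n h = binomℤ (+ n - + 2 - h) h + binomℤ (+ n - + 2 - h) h

coeff-halves : ∀ n i {a b c} → half (i - + 2) ≡ a → half (i - + 3) ≡ b → half (i - + 4) ≡ c →
  coeff n i ≡ binomℤ (+ n - + 1 - a) b + binomℤ (+ n - + 2 - b) c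
coeff-halves n i refl refl refl = refl

coeff-odd : ∀ n h → coeff n (h * + 2 + + 3) ≡ oddPart n h
coeff-odd n h = coeff-halves n (h * + 2 + + 3)
  (half-bit+double h 1 (s≤s (s≤s z≤n)) (i-2 h))
  (half-bit+double h 0 (s≤s z≤n) (i-3 h))
  (half-bit+double (h - + 1) 1 (s≤s (s≤s z≤n)) (i-4 h))
  where
  i-2 : ∀ h → h * + 2 + + 3 - + 2 ≡ + 1 + h * + 2
  i-2 = solve-∀
  i-3 : ∀ h → h * + 2 + + 3 - + 3 ≡ + 0 + h * + 2
  i-3 = solve-∀
  i-4 : ∀ h → h * + 2 + + 3 - + 4 ≡ + 1 + (h - + 1) * + 2
  i-4 = solve-∀

coeff-even : ∀ n h → coeff n (h * + 2 + + 4) ≡ evenPart n h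
coeff-even n h = trans
  (coeff-halves n (h * + 2 + + 4)
    (half-bit+double (h + + 1) 0 (s≤s z≤n) (i-2 h))
    (half-bit+double h 1 (s≤s (s≤s z≤n)) (i-3 h))
    (half-bit+double h 0 (s≤s z≤n) (i-4 h)))
  (cong (λ a → binomℤ a h + binomℤ (+ n - + 2 - h) h) (top (+ n) h))
  where
  i-2 : ∀ h → h * + 2 + + 4 - + 2 ≡ + 0 + (h + + 1) * + 2
  i-2 = solve-∀
  i-3 : ∀ h → h * + 2 + + 4 - + 3 ≡ + 1 + h * + 2
  i-3 = solve-∀
  i-4 : ∀ h → h * + 2 + + 4 - + 4 ≡ + 0 + h * + 2
  i-4 = solve-∀
  top : ∀ N h → N - + 1 - (h + + 1) ≡ N - + 2 - h
  top = solve-∀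

private
  swap-h : ∀ N c d h → N - c - h - d ≡ N - d - c - h
  swap-h = solve-∀

  shift-h : ∀ N c h → N - c - h - + 1 ≡ N - + 2 - c - (h - + 1)
  shift-h = solve-∀

oddPart-rec : ∀ m h → oddPart (3 ℕ.+ m) h ≡ oddPart (2 ℕ.+ m) h + oddPart (1 ℕ.+ m) (h - + 1)
oddPart-rec m h = begin
  B (N - + 1 - h) h + B (N - + 2 - h) (h - + 1)
    ≡⟨ cong₂ _+_ (binomℤ-pascal _ h (≡+⇒0≤ (sum₁ N h))) (binomℤ-pascal _ (h - + 1) (≡+⇒0≤ (sum₂ N h))) ⟩
  (B (N - + 1 - h - + 1) h + B (N - + 1 - h - + 1) (h - + 1))
    + (B (N - + 2 - h - + 1) (h - + 1) + B (N - + 2 - h - + 1) (h - + 1 - + 1))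
    ≡⟨ interchange (B (N - + 1 - h - + 1) h) _ _ _ ⟩
  (B (N - + 1 - h - + 1) h + B (N - + 2 - h - + 1) (h - + 1))
    + (B (N - + 1 - h - + 1) (h - + 1) + B (N - + 2 - h - + 1) (h - + 1 - + 1))
    ≡⟨ cong₂ _+_ (cong₂ _+_ (binomℤ-congˡ h (swap-h N (+ 1) (+ 1) h)) (binomℤ-congˡ (h - + 1) (swap-h N (+ 2) (+ 1) h)))
                 (cong₂ _+_ (binomℤ-congˡ (h - + 1) (shift-h N (+ 1) h)) (binomℤ-congˡ (h - + 1 - + 1) (shift-h N (+ 2) h))) ⟩
  oddPart (2 ℕ.+ m) h + oddPart (1 ℕ.+ m) (h - + 1) ∎
  where
  open ≡-Reasoning
  B : ℤ → ℤ → ℤ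
  B = binomℤ
  N : ℤ
  N = + (3 ℕ.+ m)
  sum₁ : ∀ N h → N - + 1 - h + h ≡ N - + 1
  sum₁ = solve-∀
  sum₂ : ∀ N h → N - + 2 - h + (h - + 1) ≡ N - + 3
  sum₂ = solve-∀

evenPart-rec : ∀ m h → evenPart (3 ℕ.+ m) h ≡ evenPart (2 ℕ.+ m) h + evenPart (1 ℕ.+ m) (h - + 1)
evenPart-rec m h = begin
  B (N - + 2 - h) h + B (N - + 2 - h) h
    ≡⟨ cong₂ _+_ pascal pascal ⟩
  (B (N - + 2 - h - + 1) h + B (N - + 2 - h - + 1) (h - + 1))
    + (B (N - + 2 - h - + 1) h + B (N - + 2 - h - + 1) (h - + 1))
    ≡⟨ interchange (B (N - + 2 - h - + 1) h) _ _ _ ⟩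
  (B (N - + 2 - h - + 1) h + B (N - + 2 - h - + 1) h)
    + (B (N - + 2 - h - + 1) (h - + 1) + B (N - + 2 - h - + 1) (h - + 1))
    ≡⟨ cong₂ _+_ (cong₂ _+_ (binomℤ-congˡ h (swap-h N (+ 2) (+ 1) h)) (binomℤ-congˡ h (swap-h N (+ 2) (+ 1) h)))
                 (cong₂ _+_ (binomℤ-congˡ (h - + 1) (shift-h N (+ 2) h)) (binomℤ-congˡ (h - + 1) (shift-h N (+ 2) h))) ⟩
  evenPart (2 ℕ.+ m) h + evenPart (1 ℕ.+ m) (h - + 1) ∎
  where
  open ≡-Reasoning
  B : ℤ → ℤ → ℤ
  B = binomℤ
  N : ℤ
  N = + (3 ℕ.+ m)
  sum₀ : ∀ N h → N - + 2 - h + h ≡ N - + 2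
  sum₀ = solve-∀
  pascal : B (N - + 2 - h) h ≡ B (N - + 2 - h - + 1) h + B (N - + 2 - h - + 1) (h - + 1)
  pascal = binomℤ-pascal _ h (≡+⇒0≤ (sum₀ N h))

coeff-rec : ∀ m x → coeff (3 ℕ.+ m) x ≡ coeff (2 ℕ.+ m) x + coeff (1 ℕ.+ m) (x - + 2)
coeff-rec m = ℤ-parityElim (λ x → coeff (3 ℕ.+ m) x ≡ coeff (2 ℕ.+ m) x + coeff (1 ℕ.+ m) (x - + 2))
  (λ h → begin
    coeff (3 ℕ.+ m) (h * + 2 + + 3)
      ≡⟨ coeff-odd (3 ℕ.+ m) h ⟩
    oddPart (3 ℕ.+ m) h
      ≡⟨ oddPart-rec m h ⟩
    oddPart (2 ℕ.+ m) h + oddPart (1 ℕ.+ m) (h - + 1)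
      ≡⟨ cong₂ _+_ (coeff-odd (2 ℕ.+ m) h) (coeff-odd (1 ℕ.+ m) (h - + 1)) ⟨
    coeff (2 ℕ.+ m) (h * + 2 + + 3) + coeff (1 ℕ.+ m) ((h - + 1) * + 2 + + 3)
      ≡⟨ cong (λ i → coeff (2 ℕ.+ m) (h * + 2 + + 3) + coeff (1 ℕ.+ m) i) (lower h (+ 3)) ⟨
    coeff (2 ℕ.+ m) (h * + 2 + + 3) + coeff (1 ℕ.+ m) (h * + 2 + + 3 - + 2) ∎)
  (λ h → begin
    coeff (3 ℕ.+ m) (h * + 2 + + 4)
      ≡⟨ coeff-even (3 ℕ.+ m) h ⟩
    evenPart (3 ℕ.+ m) h
      ≡⟨ evenPart-rec m h ⟩
    evenPart (2 ℕ.+ m) h + evenPart (1 ℕ.+ m) (h - + 1)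
      ≡⟨ cong₂ _+_ (coeff-even (2 ℕ.+ m) h) (coeff-even (1 ℕ.+ m) (h - + 1)) ⟨
    coeff (2 ℕ.+ m) (h * + 2 + + 4) + coeff (1 ℕ.+ m) ((h - + 1) * + 2 + + 4)
      ≡⟨ cong (λ i → coeff (2 ℕ.+ m) (h * + 2 + + 4) + coeff (1 ℕ.+ m) i) (lower h (+ 4)) ⟨
    coeff (2 ℕ.+ m) (h * + 2 + + 4) + coeff (1 ℕ.+ m) (h * + 2 + + 4 - + 2) ∎)
  where
  open ≡-Reasoning
  lower : ∀ h c → h * + 2 + c - + 2 ≡ (h - + 1) * + 2 + c
  lower = solve-∀

oddPart-1 : ∀ h → oddPart 1 h ≡ + 2 * qpow (+ 0) h
oddPart-1 (+ zero)     = refl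
oddPart-1 (+ suc _)    = refl
oddPart-1 -[1+ zero ]  = refl
oddPart-1 -[1+ suc _ ] = refl

evenPart-1 : ∀ h → evenPart 1 h ≡ + 0
evenPart-1 (+ zero)     = refl
evenPart-1 (+ suc _)    = refl
evenPart-1 -[1+ zero ]  = refl
evenPart-1 -[1+ suc _ ] = refl

oddPart-2 : ∀ h → oddPart 2 h ≡ qpow (+ 0) h
oddPart-2 (+ zero)       = refl
oddPart-2 (+ suc zero)   = refl
oddPart-2 (+ suc (suc _)) = refl
oddPart-2 -[1+ zero ]    = refl
oddPart-2 -[1+ suc _ ]   = refl

evenPart-2 : ∀ h → evenPart 2 h ≡ + 2 * qpow (+ 0) h
evenPart-2 (+ zero)     = refl
evenPart-2 (+ suc _)    = refl
evenPart-2 -[1+ zero ]  = refl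
evenPart-2 -[1+ suc _ ] = refl

coeff-1 : ∀ x → coeff 1 x ≡ + 2 * qpow (+ 3) x
coeff-1 = ℤ-parityElim (λ x → coeff 1 x ≡ + 2 * qpow (+ 3) x)
  (λ h → trans (coeff-odd 1 h) (trans (oddPart-1 h) (cong (+ 2 *_) (sym (qpow-affine (+ 0) h (+ 3))))))
  (λ h → trans (coeff-even 1 h) (trans (evenPart-1 h) (cong (+ 2 *_) (sym (qpow-wrongParity -[1+ 0 ] h (+ 4))))))

coeff-2 : ∀ x → coeff 2 x ≡ qpow (+ 3) x + + 2 * qpow (+ 4) x
coeff-2 = ℤ-parityElim (λ x → coeff 2 x ≡ qpow (+ 3) x + + 2 * qpow (+ 4) x)
  (λ h → trans (coeff-odd 2 h) (trans (oddPart-2 h) (sym (trans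
     (cong₂ (λ a b → a + + 2 * b) (qpow-affine (+ 0) h (+ 3)) (qpow-wrongParity (+ 0) h (+ 3)))
     (ℤP.+-identityʳ _)))))
  (λ h → trans (coeff-even 2 h) (trans (evenPart-2 h) (sym (trans
     (cong₂ (λ a b → a + + 2 * b) (qpow-wrongParity -[1+ 0 ] h (+ 4)) (qpow-affine (+ 0) h (+ 4)))
     (ℤP.+-identityˡ _)))))

coeff-vanish⁺ : ∀ m j → suc m ℕ.+ 2 ℕ.< j → coeff (suc m) (+ j) ≡ + 0
coeff-vanish⁺ zero j 3<j = trans (coeff-1 (+ j)) (cong (+ 2 *_) (qpow-off (ℕP.>⇒≢ 3<j ∘ ℤP.+-injective)))
coeff-vanish⁺ (suc zero) j 4<j = trans (coeff-2 (+ j))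
  (cong₂ (λ a b → a + + 2 * b) (qpow-off (ℕP.>⇒≢ (ℕP.<-trans (ℕP.n<1+n 3) 4<j) ∘ ℤP.+-injective))
                               (qpow-off (ℕP.>⇒≢ 4<j ∘ ℤP.+-injective)))
coeff-vanish⁺ (suc (suc m)) (suc (suc j)) (s≤s (s≤s m+4<j)) = trans (coeff-rec m (+ suc (suc j)))
  (cong₂ _+_ (coeff-vanish⁺ (suc m) (suc (suc j)) (s≤s (ℕP.m≤n⇒m≤1+n m+4<j))) (coeff-vanish⁺ m j m+4<j))

coeff-vanish⁻ : ∀ m p → coeff (suc m) -[1+ p ] ≡ + 0
coeff-vanish⁻ zero          p = coeff-1 -[1+ p ]
coeff-vanish⁻ (suc zero)    p = coeff-2 -[1+ p ]
coeff-vanish⁻ (suc (suc m)) p = trans (coeff-rec m -[1+ p ])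
  (cong₂ _+_ (coeff-vanish⁻ (suc m) p) (coeff-vanish⁻ m (suc (p ℕ.+ 1))))

d4≡coeff : ∀ m k → d4 (suc m) k ≡ coeff (suc m) (k + + 3)
d4≡coeff zero k = trans (d4-1 k) (sym (trans (coeff-1 (k + + 3)) (cong (+ 2 *_) (qpow-translate (+ 0) k (+ 3)))))
d4≡coeff (suc zero) k = trans (d4-2 k) (sym (trans (coeff-2 (k + + 3))
  (cong₂ (λ a b → a + + 2 * b) (qpow-translate (+ 0) k (+ 3)) (qpow-translate (+ 1) k (+ 3)))))
d4≡coeff (suc (suc m)) k = begin
  d4 (3 ℕ.+ m) k
    ≡⟨ d4-rec m k ⟩
  d4 (2 ℕ.+ m) k + d4 (1 ℕ.+ m) (k - + 2)
    ≡⟨ cong₂ _+_ (d4≡coeff (suc m) k) (d4≡coeff m (k - + 2)) ⟩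
  coeff (2 ℕ.+ m) (k + + 3) + coeff (1 ℕ.+ m) (k - + 2 + + 3)
    ≡⟨ cong (λ i → coeff (2 ℕ.+ m) (k + + 3) + coeff (1 ℕ.+ m) i) (reorder k) ⟩
  coeff (2 ℕ.+ m) (k + + 3) + coeff (1 ℕ.+ m) (k + + 3 - + 2)
    ≡⟨ coeff-rec m (k + + 3) ⟨
  coeff (3 ℕ.+ m) (k + + 3) ∎
  where
  open ≡-Reasoning
  reorder : ∀ k → k - + 2 + + 3 ≡ k + + 3 - + 2
  reorder = solve-∀

theorem3p7 :
  (∀ (n : ℕ) → 3 ≤ n → d4 n ≗ d4 (n Data.Nat.∸ 1) ⊕ (d4 (n Data.Nat.∸ 2) ·q^ (+ 2)))
  × (d4 1 ≗ (+ 2) ⊙ qpow (+ 0))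
  × (d4 2 ≗ qpow (+ 0) ⊕ (+ 2) ⊙ qpow (+ 1))
  × (∀ (n : ℕ) → 1 ≤ n →
       d4 n ≗ ΣP (n Data.Nat.+ 2) (λ i →
         (binomℤ (+ n - + 1 - half (+ i - + 2)) (half (+ i - + 3))
           + binomℤ (+ n - + 2 - half (+ i - + 3)) (half (+ i - + 4)))
         ⊙ qpow (+ i - + 3)))
theorem3p7 = recurrence , d4-1 , d4-2 , closedForm
  where
  recurrence : ∀ n → 3 ≤ n → d4 n ≗ d4 (n ℕ.∸ 1) ⊕ (d4 (n ℕ.∸ 2) ·q^ (+ 2))
  recurrence (suc (suc (suc m))) (s≤s (s≤s (s≤s _))) = d4-rec m
  closedForm : ∀ n → 1 ≤ n → d4 n ≗ ΣP (n ℕ.+ 2) (λ i → coeff n (+ i) ⊙ qpow (+ i - + 3))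
  closedForm (suc m) (s≤s _) k = trans (d4≡coeff m k)
    (sym (ΣP-coefficients (suc m ℕ.+ 2) (coeff (suc m)) (+ 3) (coeff-vanish⁺ m) (coeff-vanish⁻ m) k))
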